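{- Let $\ell\geq2$, let $G$ be a graph with girth $2\ell+1$ and no odd hole of length at least $2\ell+3$, and let $C$ be an odd hole of $G$. Let $s,t\in V(C)$ be nonadjacent, let $Q_1,Q_2$ be the two internally disjoint $(s,t)$-paths of $C$, and let $P$ be an $(s,t)$-jump over $C$. If $P$ is a local jump over $C$ across $Q_1^*$ or a short jump over $C$ across $Q_1^*$, then $|P|$ and $|Q_2|$ have the same parity; that is, $P\cup Q_2$ is an even hole and $P\cup Q_1$ is an odd cycle.
   Context: Graphs are finite and simple; $|F|$ is the number of edges of a path/cycle $F$, and $F^*$ the set of internal vertices of a path $F$. A hole is an induced cycle of length at least four; odd according to its length. Let $C$ be an odd hole, $s,t\in V(C)$ nonadjacent, and $Q_1,Q_2$ the two internally disjoint $(s,t)$-paths of $C$. An induced $(s,t)$-path $P$ with $V(P^*)\cap V(C)=\emptyset$ is a jump (an $(s,t)$-jump) over $C$. $P$ is a local jump over $C$ across $Q_1^*$ if some vertex of $Q_1^*$ has a neighbour in $P^*$ and no vertex of $Q_2^*$ has a neighbour in $P^*$. $P$ is a short jump over $C$ if no vertex of $Q_1^*\cup Q_2^*$ has a neighbour in $P^*$; if moreover $P\cup Q_1$ is an odd hole, $P\cup Q_1$ is called a jump hole over $C$ and $P$ is a short jump over $C$ across $Q_1^*$. -}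

module Defs where

open import Data.Nat using (ℕ; zero; suc; _+_; _*_; _≤_; _<_; _%_)
open import Data.Fin using (Fin; toℕ)
open import Data.List using (List; []; _∷_; _++_; [_]; length; lookup; reverse)
open import Data.List.Relation.Unary.Linked using (Linked)
open import Data.List.Relation.Unary.Unique.Propositional using (Unique)
open import Data.List.Membership.Propositional using (_∈_; _∉_)
open import Data.Product using (_×_; Σ; ∃; ∃-syntax)
open import Data.Sum using (_⊎_)
open import Relation.Nullary using (¬_)
open import Relation.Binary.PropositionalEquality using (_≡_)
open import Level using (0ℓ)

record Graph (n : ℕ) : Set₁ where
  field
    Adj     : Fin n → Fin n → Set
    sym     : ∀ {u v} → Adj u v → Adj v u
    irrefl  : ∀ {u} → ¬ Adj u u

open Graph public

module _ {n : ℕ} (G : Graph n) where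

  IsPath : List (Fin n) → Set
  IsPath xs = Unique xs × Linked (Adj G) xs

  IsInducedPath : List (Fin n) → Set
  IsInducedPath xs = IsPath xs ×
    (∀ (i j : Fin (length xs)) → Adj G (lookup xs i) (lookup xs j) →
       toℕ j ≡ suc (toℕ i) ⊎ toℕ i ≡ suc (toℕ j))

  -- A cycle given by its cyclic vertex sequence x ∷ ys (length ≥ 3):
  -- distinct vertices, cyclically consecutive ones adjacent.
  -- Its length (number of edges) equals the number of vertices.
  IsCycle : List (Fin n) → Set
  IsCycle [] = Data.Empty.⊥ where import Data.Empty
  IsCycle (x ∷ ys) = 3 ≤ length (x ∷ ys) × Unique (x ∷ ys) × Linked (Adj G) (x ∷ ys ++ [ x ])

  CycConsec : (k : ℕ) → ℕ → ℕ → Set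
  CycConsec k i j = j ≡ suc i ⊎ i ≡ suc j ⊎ (i ≡ 0 × suc j ≡ k) ⊎ (j ≡ 0 × suc i ≡ k)

  IsInducedCycle : List (Fin n) → Set
  IsInducedCycle xs = IsCycle xs ×
    (∀ (i j : Fin (length xs)) → Adj G (lookup xs i) (lookup xs j) →
       CycConsec (length xs) (toℕ i) (toℕ j))

  IsHole : List (Fin n) → Set
  IsHole xs = IsInducedCycle xs × 4 ≤ length xs

  OddLen : List (Fin n) → Set
  OddLen xs = length xs % 2 ≡ 1

  IsOddHole : List (Fin n) → Set
  IsOddHole xs = IsHole xs × OddLen xs

  HasGirth : ℕ → Set
  HasGirth g = (∃[ cs ] (IsCycle cs × length cs ≡ g)) ×
               (∀ cs → IsCycle cs → g ≤ length cs)

  NoOddHoleOfLengthAtLeast : ℕ → Set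
  NoOddHoleOfLengthAtLeast m = ∀ cs → IsOddHole cs → ¬ (m ≤ length cs)

-- Conventions for the lemma: an (s,t)-path with interior vertex list q is the
-- vertex sequence  s ∷ q ++ [ t ]  and has  length q + 1  edges.
pathOf : {n : ℕ} → Fin n → List (Fin n) → Fin n → List (Fin n)
pathOf s q t = s ∷ q ++ [ t ]

-- The cycle formed by two (s,t)-paths with interiors q₁, q₂:
-- s, q₁, t, then q₂ traversed backwards.
cycleOf : {n : ℕ} → Fin n → List (Fin n) → Fin n → List (Fin n) → List (Fin n)
cycleOf s q₁ t q₂ = s ∷ q₁ ++ t ∷ reverse q₂

∣path∣ : {n : ℕ} → List (Fin n) → ℕ
∣path∣ q = length q + 1

module _ {n : ℕ} (G : Graph n) where

  IsJump : Fin n → Fin n → List (Fin n) → List (Fin n) → List (Fin n) → Set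
  IsJump s t q₁ q₂ p =
    IsInducedPath G (pathOf s p t) × (∀ {w} → w ∈ p → w ∉ cycleOf s q₁ t q₂)

  IsLocalJumpAcross₁ : Fin n → Fin n → List (Fin n) → List (Fin n) → List (Fin n) → Set
  IsLocalJumpAcross₁ s t q₁ q₂ p =
    (∃[ v ] ∃[ w ] (v ∈ q₁ × w ∈ p × Adj G v w)) ×
    (∀ {v w} → v ∈ q₂ → w ∈ p → ¬ Adj G v w)

  IsShortJumpAcross₁ : Fin n → Fin n → List (Fin n) → List (Fin n) → List (Fin n) → Set
  IsShortJumpAcross₁ s t q₁ q₂ p =
    (∀ {v w} → v ∈ q₁ → w ∈ p → ¬ Adj G v w) ×
    (∀ {v w} → v ∈ q₂ → w ∈ p → ¬ Adj G v w) ×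
    IsOddHole G (cycleOf s q₁ t p)

{-# OPTIONS --safe #-}

-- Write |F| for the number of edges. For a short jump, C = Q₁ ∪ Q₂ and P ∪ Q₁ are both odd
-- holes, so |Q₂| ≡ |Q₁| + 1 ≡ |P| (mod 2).
-- For a local jump, pick an edge vw with v ∈ Q₁* and w ∈ P*, and suppose |P| ≢ |Q₂| (mod 2).
-- Since s and t are nonadjacent, Q₂* is nonempty, and as P and Q₂ are induced and no vertex of
-- Q₂* has a neighbour in P*, P ∪ Q₂ is an odd hole. By the girth, the cycles s Q₁ v w P s and
-- v Q₁ t P w v both have length at least 2ℓ + 1, so |Q₁| + |P| + 2 ≥ 4ℓ + 2, while |C| < 2ℓ + 3.
-- With |Q₂| ≥ 2 this gives |P ∪ Q₂| ≥ 2ℓ + 2, hence ≥ 2ℓ + 3 by parity: a forbidden odd hole.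
module Submission where

open import Defs hiding (sym)
open import Data.Empty using (⊥-elim)
open import Data.Fin using (Fin; toℕ; zero; suc)
open import Data.List using (List; []; _∷_; _++_; [_]; _∷ʳ_; _ʳ++_; length; lookup; reverse; drop)
open import Data.List.Properties
  using (++-assoc; length-++; length-reverse; ++-ʳ++; ʳ++-defn; reverse-involutive)
open import Data.List.Membership.Propositional using (_∈_; _∉_)
open import Data.List.Membership.Propositional.Properties
  using (∈-++⁺ˡ; ∈-++⁺ʳ; ∈-++⁻; ∈-∃++; ∈-lookup)
open import Data.List.Membership.Setoid.Properties using (reverse⁺; reverse⁻)
open import Data.List.Relation.Binary.Disjoint.Propositional using (Disjoint)
open import Data.List.Relation.Binary.Permutation.Propositional using (↭⇒↭ₛ; ↭-sym)
open import Data.List.Relation.Binary.Permutation.Propositional.Properties using (↭-reverse)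
open import Data.List.Relation.Binary.Permutation.Setoid.Properties using (Unique-resp-↭)
open import Data.List.Relation.Unary.All as All using (All; []; _∷_)
import Data.List.Relation.Unary.All.Properties as All
open import Data.List.Relation.Unary.Any using (here; there; index)
open import Data.List.Relation.Unary.Any.Properties using (lookup-index)
open import Data.List.Relation.Unary.Linked using (Linked; []; [-]; _∷_)
open import Data.List.Relation.Unary.Unique.Propositional using (Unique; []; _∷_)
open import Data.List.Relation.Unary.Unique.Propositional.Properties using (++⁺; Unique[x∷xs]⇒x∉xs)
open import Data.Nat using (ℕ; suc; _+_; _*_; _≤_; _<_; _%_; s≤s; z≤n)
open import Data.Nat.Properties
  using (suc-injective; 1+n≢0; 0≢1+n; +-assoc; +-suc; *-comm; ≤-trans; ≤-pred; ≰⇒>; m≤n⇒m<n∨m≡n;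
         m≤m+n; m≤n+m; +-mono-≤; +-monoˡ-≤; +-monoʳ-≤; +-cancelˡ-≤; +-cancelʳ-≤; module ≤-Reasoning)
open import Data.Nat.DivMod using ([m+n]%n≡m%n; m*n%n≡0)
open import Data.Nat.Tactic.RingSolver using (solve-∀)
open import Data.Product using (_×_; _,_; proj₁; proj₂; map₁)
open import Data.Sum as Sum using (_⊎_; inj₁; inj₂)
open import Data.Unit using (⊤; tt)
open import Function using (_∘_; _⇔_; mk⇔; Equivalence)
open import Level using (Level)
open import Relation.Binary using (Symmetric)
open import Relation.Binary.PropositionalEquality
  using (_≡_; refl; sym; trans; cong; subst; setoid; module ≡-Reasoning)
open import Relation.Nullary using (¬_)

private variable
  a r : Level
  A : Set a

-- Lists

length-∷ʳ : ∀ (xs : List A) x → length (xs ∷ʳ x) ≡ suc (length xs)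
length-∷ʳ []       x = refl
length-∷ʳ (_ ∷ xs) x = cong suc (length-∷ʳ xs x)

∈-∷ʳ⁻ : ∀ {u y : A} xs → u ∈ xs ∷ʳ y → u ∈ y ∷ xs
∈-∷ʳ⁻ xs u∈ = Sum.[ there , (λ { (here refl) → here refl }) ] (∈-++⁻ xs u∈)

Unique-reverse : ∀ {xs : List A} → Unique xs → Unique (reverse xs)
Unique-reverse {A = A} {xs} = Unique-resp-↭ (setoid A) (↭⇒↭ₛ (↭-sym (↭-reverse xs)))

Unique-++⁻ : ∀ (xs : List A) {ys} → Unique (xs ++ ys) → Unique xs × Unique ys × Disjoint xs ys
Unique-++⁻ []       u           = [] , u , λ ()
Unique-++⁻ (x ∷ xs) (x∉ ∷ u) with Unique-++⁻ xs u
... | uxs , uys , xs#ys =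
  All.++⁻ˡ xs x∉ ∷ uxs , uys ,
  λ { (here refl , v∈ys) → All.lookup (All.++⁻ʳ xs x∉) v∈ys refl
    ; (there v∈xs , v∈ys) → xs#ys (v∈xs , v∈ys) }

Unique-∷ʳ : ∀ {xs : List A} {y} → Unique xs → y ∉ xs → Unique (xs ∷ʳ y)
Unique-∷ʳ u y∉ = ++⁺ u ([] ∷ []) λ { (v∈xs , here refl) → y∉ v∈xs }

module _ {R : A → A → Set r} where

  Linked-split : ∀ xs {y ys} → Linked R (xs ++ y ∷ ys) → Linked R (xs ∷ʳ y) × Linked R (y ∷ ys)
  Linked-split []           l       = [-] , l
  Linked-split (x ∷ [])     (r ∷ l) = r ∷ [-] , l
  Linked-split (x ∷ x′ ∷ xs) (r ∷ l) = map₁ (r ∷_) (Linked-split (x′ ∷ xs) l)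

  Linked-join : ∀ xs {y ys} → Linked R (xs ∷ʳ y) → Linked R (y ∷ ys) → Linked R (xs ++ y ∷ ys)
  Linked-join []            _        l₂ = l₂
  Linked-join (x ∷ [])      (r ∷ _)  l₂ = r ∷ l₂
  Linked-join (x ∷ x′ ∷ xs) (r ∷ l₁) l₂ = r ∷ Linked-join (x′ ∷ xs) l₁ l₂

  Linked-ʳ++ : Symmetric R → ∀ xs {y acc} → Linked R (y ∷ xs) → Linked R (y ∷ acc) →
               Linked R (xs ʳ++ y ∷ acc)
  Linked-ʳ++ sym []       _       l₂ = l₂
  Linked-ʳ++ sym (x ∷ xs) (r ∷ l) l₂ = Linked-ʳ++ sym xs l (sym r ∷ l₂)

  Linked-reverse : Symmetric R → ∀ {xs} → Linked R xs → Linked R (reverse xs)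
  Linked-reverse sym {[]}     l = l
  Linked-reverse sym {x ∷ xs} l = Linked-ʳ++ sym xs l [-]

-- Parity and length arithmetic

sameParity⊎oddSum : ∀ a b → a % 2 ≡ b % 2 ⊎ (a + b) % 2 ≡ 1
sameParity⊎oddSum (suc (suc a)) b             = sameParity⊎oddSum a b
sameParity⊎oddSum 0             0             = inj₁ refl
sameParity⊎oddSum 0             1             = inj₂ refl
sameParity⊎oddSum 0             (suc (suc b)) = sameParity⊎oddSum 0 b
sameParity⊎oddSum 1             0             = inj₂ refl
sameParity⊎oddSum 1             1             = inj₁ refl
sameParity⊎oddSum 1             (suc (suc b)) = sameParity⊎oddSum 1 b

odd-suc⇒even : ∀ a → suc a % 2 ≡ 1 → a % 2 ≡ 0
odd-suc⇒even 0             _ = refl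
odd-suc⇒even 1             ()
odd-suc⇒even (suc (suc a)) h = odd-suc⇒even a h

oddSums⇒sameParity : ∀ c a b → (c + a) % 2 ≡ 1 → (c + b) % 2 ≡ 1 → a % 2 ≡ b % 2
oddSums⇒sameParity 0             a b h₁ h₂ = trans h₁ (sym h₂)
oddSums⇒sameParity 1             a b h₁ h₂ = trans (odd-suc⇒even a h₁) (sym (odd-suc⇒even b h₂))
oddSums⇒sameParity (suc (suc c)) a b h₁ h₂ = oddSums⇒sameParity c a b h₁ h₂

odd-above-even : ∀ ℓ m → 2 * ℓ + 2 ≤ m → m % 2 ≡ 1 → 2 * ℓ + 3 ≤ m
odd-above-even ℓ m le odd with m≤n⇒m<n∨m≡n le
... | inj₁ lt   = subst (_≤ m) (sym (+-suc (2 * ℓ) 2)) lt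
... | inj₂ refl = ⊥-elim (0≢1+n (trans (sym even) odd))
  where
  even : (2 * ℓ + 2) % 2 ≡ 0
  even = trans ([m+n]%n≡m%n (2 * ℓ) 2) (trans (cong (_% 2) (*-comm 2 ℓ)) (m*n%n≡0 ℓ 2))

-- α, β (γ, δ) are the lengths of the two parts of Q₁ (of P) cut at the chord, b = |Q₂|;
-- the hypotheses are the girth bounds on the two chord cycles and |C| ≤ L + 2.
chordArith : ∀ L α β γ δ b → L + 1 ≤ α + 1 + γ → L + 1 ≤ β + suc δ →
             (α + β) + b ≤ L + 2 → 2 ≤ b → L + 2 ≤ (γ + δ) + b
chordArith L α β γ δ b h₁ h₂ h₃ b≥2 = +-cancelʳ-≤ 2 (L + 2) (γ + δ + b) (begin
  L + 2 + 2          ≡⟨ +-assoc L 2 2 ⟩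
  L + (2 + 2)        ≤⟨ +-monoʳ-≤ L (+-mono-≤ b≥2 b≥2) ⟩
  L + (b + b)        ≡⟨ +-assoc L b b ⟨
  L + b + b          ≤⟨ +-monoˡ-≤ b L+b≤γ+δ+2 ⟩
  γ + δ + 2 + b      ≡⟨ e₃ γ δ b ⟩
  γ + δ + b + 2      ∎)
  where
  open ≤-Reasoning
  e₁ : ∀ L α β b → α + β + L + 2 + (L + b) ≡ L + 1 + (L + 1) + (α + β + b)
  e₁ = solve-∀
  e₂ : ∀ L α β γ δ → α + 1 + γ + (β + suc δ) + (L + 2) ≡ α + β + L + 2 + (γ + δ + 2)
  e₂ = solve-∀
  e₃ : ∀ γ δ b → γ + δ + 2 + b ≡ γ + δ + b + 2
  e₃ = solve-∀
  L+b≤γ+δ+2 : L + b ≤ γ + δ + 2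
  L+b≤γ+δ+2 = +-cancelˡ-≤ (α + β + L + 2) (L + b) (γ + δ + 2) (begin
    α + β + L + 2 + (L + b)                ≡⟨ e₁ L α β b ⟩
    L + 1 + (L + 1) + (α + β + b)          ≤⟨ +-mono-≤ (+-mono-≤ h₁ h₂) h₃ ⟩
    α + 1 + γ + (β + suc δ) + (L + 2)      ≡⟨ e₂ L α β γ δ ⟩
    α + β + L + 2 + (γ + δ + 2)            ∎)

-- Paths and cycles through s and t

pathOf-reverse : ∀ {n} (s : Fin n) q t → reverse (pathOf s q t) ≡ pathOf t (reverse q) s
pathOf-reverse s q t = trans (++-ʳ++ q) (cong (t ∷_) (ʳ++-defn q))

pathOf-reverse′ : ∀ {n} (s : Fin n) q t → reverse (pathOf t (reverse q) s) ≡ pathOf s q t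
pathOf-reverse′ s q t =
  trans (pathOf-reverse t (reverse q) s) (cong (λ q′ → pathOf s q′ t) (reverse-involutive q))

pathOf-++ : ∀ {n} (s : Fin n) A v B t → pathOf s (A ++ v ∷ B) t ≡ (s ∷ A) ++ pathOf v B t
pathOf-++ s A v B t = cong (s ∷_) (++-assoc A (v ∷ B) [ t ])

cycleOf-closed : ∀ {n} (s : Fin n) q₁ t q₂ →
  s ∷ (q₁ ++ t ∷ reverse q₂) ++ [ s ] ≡ (s ∷ q₁) ++ pathOf t (reverse q₂) s
cycleOf-closed s q₁ t q₂ = cong (s ∷_) (++-assoc q₁ (t ∷ reverse q₂) [ s ])

cycleOf-∷ʳ : ∀ {n} (s : Fin n) q₁ t z q₂ →
  cycleOf s q₁ t (z ∷ q₂) ≡ s ∷ (q₁ ++ t ∷ reverse q₂) ∷ʳ z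
cycleOf-∷ʳ s q₁ t z q₂ = cong (s ∷_) (begin
  q₁ ++ t ∷ reverse (z ∷ q₂)       ≡⟨ cong (λ r → q₁ ++ t ∷ r) (ʳ++-defn q₂) ⟩
  q₁ ++ (t ∷ reverse q₂) ∷ʳ z      ≡⟨ ++-assoc q₁ (t ∷ reverse q₂) [ z ] ⟨
  (q₁ ++ t ∷ reverse q₂) ∷ʳ z      ∎)
  where open ≡-Reasoning

∈pathOf⇒∈cycleOf : ∀ {n} {s : Fin n} {q₁ t q₂ u} →
  u ∈ pathOf s q₁ t → u ∈ cycleOf s q₁ t q₂
∈pathOf⇒∈cycleOf (here refl) = here refl
∈pathOf⇒∈cycleOf {q₁ = q₁} (there u∈) with ∈-++⁻ q₁ u∈
... | inj₁ u∈q₁        = there (∈-++⁺ˡ u∈q₁)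
... | inj₂ (here refl) = there (∈-++⁺ʳ q₁ (here refl))

∈q₂⇒∈cycleOf : ∀ {n} {s : Fin n} {q₁ t q₂ u} → u ∈ q₂ → u ∈ cycleOf s q₁ t q₂
∈q₂⇒∈cycleOf {q₁ = q₁} u∈ = there (∈-++⁺ʳ q₁ (there (reverse⁺ (setoid _) u∈)))

length-cycleOf : ∀ {n} (s : Fin n) q₁ t q₂ →
  length (cycleOf s q₁ t q₂) ≡ ∣path∣ q₁ + ∣path∣ q₂
length-cycleOf s q₁ t q₂ = begin
  suc (length (q₁ ++ t ∷ reverse q₂))
    ≡⟨ cong suc (length-++ q₁) ⟩
  suc (length q₁ + suc (length (reverse q₂)))
    ≡⟨ cong (λ m → suc (length q₁ + suc m)) (length-reverse q₂) ⟩
  suc (length q₁ + suc (length q₂))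
    ≡⟨ arith (length q₁) (length q₂) ⟩
  length q₁ + 1 + (length q₂ + 1)
    ∎
  where
  open ≡-Reasoning
  arith : ∀ a b → suc (a + suc b) ≡ a + 1 + (b + 1)
  arith = solve-∀

∣path∣-split : ∀ {n} (A : List (Fin n)) v B → ∣path∣ (A ++ v ∷ B) ≡ ∣path∣ A + ∣path∣ B
∣path∣-split A v B = begin
  length (A ++ v ∷ B) + 1           ≡⟨ cong (_+ 1) (length-++ A) ⟩
  length A + suc (length B) + 1     ≡⟨ arith (length A) (length B) ⟩
  length A + 1 + (length B + 1)     ∎
  where
  open ≡-Reasoning
  arith : ∀ a b → a + suc b + 1 ≡ a + 1 + (b + 1)
  arith = solve-∀

3≤∣path∣+∣path∣ : ∀ {n} {u : Fin n} q₁ q₂ → u ∈ q₁ ++ q₂ → 3 ≤ ∣path∣ q₁ + ∣path∣ q₂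
3≤∣path∣+∣path∣ (_ ∷ q₁) q₂ _ =
  s≤s (+-mono-≤ (m≤n+m 1 (length q₁)) (m≤n+m 1 (length q₂)))
3≤∣path∣+∣path∣ [] (_ ∷ q₂) _ = s≤s (s≤s (m≤n+m 1 (length q₂)))

module _ {n : ℕ} (G : Graph n) where

  private
    V : Set
    V = Fin n

  IsPath-split : ∀ xs {y ys} → IsPath G (xs ++ y ∷ ys) → IsPath G (xs ∷ʳ y) × IsPath G (y ∷ ys)
  IsPath-split xs (u , l) with Unique-++⁻ xs u | Linked-split xs l
  ... | uxs , uys , xs#ys | lxs , lys =
    (Unique-∷ʳ uxs (λ y∈ → xs#ys (y∈ , here refl)) , lxs) , (uys , lys)

  IsPath-join : ∀ xs {y ys} → IsPath G (xs ∷ʳ y) → IsPath G (y ∷ ys) → Disjoint xs (y ∷ ys) →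
                IsPath G (xs ++ y ∷ ys)
  IsPath-join xs (u₁ , l₁) (u₂ , l₂) xs#ys =
    ++⁺ (proj₁ (Unique-++⁻ xs u₁)) u₂ xs#ys , Linked-join xs l₁ l₂

  IsPath-reverse : ∀ {xs} → IsPath G xs → IsPath G (reverse xs)
  IsPath-reverse (u , l) = Unique-reverse u , Linked-reverse (Graph.sym G) l

  edge-isPath : ∀ {v w} → Adj G v w → IsPath G (v ∷ [ w ])
  edge-isPath a = ((λ { refl → irrefl G a }) ∷ []) ∷ [] ∷ [] , a ∷ [-]

  IsPath-pathOf-split : ∀ {s t v} A B → IsPath G (pathOf s (A ++ v ∷ B) t) →
                        IsPath G (pathOf s A v) × IsPath G (pathOf v B t)
  IsPath-pathOf-split {s} {t} {v} A B p = IsPath-split (s ∷ A) (subst (IsPath G) (pathOf-++ s A v B t) p)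

  IsPath-pathOf-join : ∀ {s t v} A B → IsPath G (pathOf s A v) → IsPath G (pathOf v B t) →
                       Disjoint (s ∷ A) (pathOf v B t) → IsPath G (pathOf s (A ++ v ∷ B) t)
  IsPath-pathOf-join {s} {t} {v} A B p₁ p₂ d =
    subst (IsPath G) (sym (pathOf-++ s A v B t)) (IsPath-join (s ∷ A) p₁ p₂ d)

  IsCycle-cycleOf⁻ : ∀ s q₁ t q₂ → IsCycle G (cycleOf s q₁ t q₂) →
                     IsPath G (pathOf s q₁ t) × IsPath G (pathOf s q₂ t)
  IsCycle-cycleOf⁻ s q₁ t q₂ (_ , u , l)
    with Unique-++⁻ (s ∷ q₁) u
       | Linked-split (s ∷ q₁) (subst (Linked (Adj G)) (cycleOf-closed s q₁ t q₂) l)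
  ... | u₁ , u₂ , d | l₁ , l₂ =
    (Unique-∷ʳ u₁ (λ t∈ → d (t∈ , here refl)) , l₁) ,
    subst (IsPath G) (pathOf-reverse′ s q₂ t)
      (IsPath-reverse (Unique-∷ʳ u₂ (λ s∈ → d (here refl , s∈)) , l₂))

  IsCycle-cycleOf⁺ : ∀ s q₁ t q₂ → IsPath G (pathOf s q₁ t) → IsPath G (pathOf s q₂ t) →
                     Disjoint q₁ q₂ → 3 ≤ ∣path∣ q₁ + ∣path∣ q₂ →
                     IsCycle G (cycleOf s q₁ t q₂)
  IsCycle-cycleOf⁺ s q₁ t q₂ (u₁ , l₁) p₂ q₁#q₂ len =
    subst (3 ≤_) (sym (length-cycleOf s q₁ t q₂)) len ,
    ++⁺ (proj₁ (Unique-++⁻ (s ∷ q₁) u₁)) (proj₁ (Unique-++⁻ (t ∷ R) u₂)) d ,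
    subst (Linked (Adj G)) (sym (cycleOf-closed s q₁ t q₂)) (Linked-join (s ∷ q₁) l₁ l₂)
    where
    R : List V
    R = reverse q₂
    p₂ʳ : IsPath G (pathOf t R s)
    p₂ʳ = subst (IsPath G) (pathOf-reverse s q₂ t) (IsPath-reverse p₂)
    u₂ : Unique (pathOf t R s)
    u₂ = proj₁ p₂ʳ
    l₂ : Linked (Adj G) (pathOf t R s)
    l₂ = proj₂ p₂ʳ
    sq₁#t : Disjoint (s ∷ q₁) [ t ]
    sq₁#t = proj₂ (proj₂ (Unique-++⁻ (s ∷ q₁) u₁))
    tR#s : Disjoint (t ∷ R) [ s ]
    tR#s = proj₂ (proj₂ (Unique-++⁻ (t ∷ R) u₂))
    d : Disjoint (s ∷ q₁) (t ∷ R)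
    d (v∈ , here refl)            = sq₁#t (v∈ , here refl)
    d (here refl , there v∈R)     = tR#s (there v∈R , here refl)
    d (there v∈q₁ , there v∈R)    = q₁#q₂ (v∈q₁ , reverse⁻ (setoid V) v∈R)

  -- Chordless paths and cycles

  NoEdges : List V → List V → Set
  NoEdges xs ys = ∀ {x y} → x ∈ xs → y ∈ ys → ¬ Adj G x y

  NonAdjacent : V → List V → Set
  NonAdjacent x = All (λ y → ¬ Adj G x y)

  -- The index conditions of IsInducedPath and IsInducedCycle (ChordlessByIndex and
  -- CycleChordlessByIndex below) are equivalent to this recursive form, which is the one
  -- that behaves well under _++_ and reverse.
  Chordless : List V → Set
  Chordless []       = ⊤
  Chordless (x ∷ xs) = NonAdjacent x (drop 1 xs) × Chordless xs

  Chordless-++⁻ : ∀ xs {ys} → Chordless (xs ++ ys) → Chordless xs × Chordless ys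
  Chordless-++⁻ []            c       = tt , c
  Chordless-++⁻ (x ∷ [])      (_ , c) = ([] , tt) , c
  Chordless-++⁻ (x ∷ x′ ∷ xs) (f , c) = map₁ (All.++⁻ˡ xs f ,_) (Chordless-++⁻ (x′ ∷ xs) c)

  Chordless-join : ∀ xs {y ys} → Chordless (xs ∷ʳ y) → Chordless (y ∷ ys) → NoEdges xs ys →
                   Chordless (xs ++ y ∷ ys)
  Chordless-join []            _        c₂ _  = c₂
  Chordless-join (x ∷ [])      _        c₂ ne = All.tabulate (ne (here refl)) , c₂
  Chordless-join (x ∷ x′ ∷ xs) (f , c₁) c₂ ne =
    All.++⁺ (All.++⁻ˡ xs f) (All.head (All.++⁻ʳ xs f) ∷ All.tabulate (ne (here refl))) ,
    Chordless-join (x′ ∷ xs) c₁ c₂ (λ x∈ → ne (there x∈))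

  Chordless-ʳ++ : ∀ xs {y acc} → Chordless (y ∷ xs) → Chordless (y ∷ acc) → NoEdges xs acc →
                  Chordless (xs ʳ++ y ∷ acc)
  Chordless-ʳ++ []       _         c₂ _  = c₂
  Chordless-ʳ++ (x ∷ xs) {y} {acc} (y#xs , c₁) c₂ ne =
    Chordless-ʳ++ xs c₁ (All.tabulate (ne (here refl)) , c₂) ne′
    where
    ne′ : NoEdges xs (y ∷ acc)
    ne′ u∈ (here refl) a = All.lookup y#xs u∈ (Graph.sym G a)
    ne′ u∈ (there v∈)    = ne (there u∈) v∈

  Chordless-reverse : ∀ {xs} → Chordless xs → Chordless (reverse xs)
  Chordless-reverse {[]}     c = c
  Chordless-reverse {x ∷ xs} c = Chordless-ʳ++ xs c ([] , tt) (λ _ ())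

  ChordlessByIndex : List V → Set
  ChordlessByIndex xs = ∀ (i j : Fin (length xs)) → Adj G (lookup xs i) (lookup xs j) →
    toℕ j ≡ suc (toℕ i) ⊎ toℕ i ≡ suc (toℕ j)

  CycleChordlessByIndex : List V → Set
  CycleChordlessByIndex xs = ∀ (i j : Fin (length xs)) → Adj G (lookup xs i) (lookup xs j) →
    CycConsec G (length xs) (toℕ i) (toℕ j)

  AdjacentOnlyAt : V → (ys : List V) → (ℕ → Set) → Set
  AdjacentOnlyAt x ys P = ∀ j → Adj G x (lookup ys j) → P (toℕ j)

  CycConsec-sym : ∀ {k i j} → CycConsec G k i j → CycConsec G k j i
  CycConsec-sym (inj₁ e)               = inj₂ (inj₁ e)
  CycConsec-sym (inj₂ (inj₁ e))        = inj₁ e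
  CycConsec-sym (inj₂ (inj₂ (inj₁ e))) = inj₂ (inj₂ (inj₂ e))
  CycConsec-sym (inj₂ (inj₂ (inj₂ e))) = inj₂ (inj₂ (inj₁ e))

  ChordlessByIndex-∷ : ∀ x ys →
    ChordlessByIndex (x ∷ ys) ⇔ (AdjacentOnlyAt x ys (_≡ 0) × ChordlessByIndex ys)
  ChordlessByIndex-∷ x ys = mk⇔ to from
    where
    onlyHead : ∀ {k} → suc k ≡ 1 ⊎ 0 ≡ suc (suc k) → k ≡ 0
    onlyHead (inj₁ e) = suc-injective e
    to : ChordlessByIndex (x ∷ ys) → AdjacentOnlyAt x ys (_≡ 0) × ChordlessByIndex ys
    to h = (λ j a → onlyHead (h zero (suc j) a)) ,
           (λ i j a → Sum.map suc-injective suc-injective (h (suc i) (suc j) a))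
    from : AdjacentOnlyAt x ys (_≡ 0) × ChordlessByIndex ys → ChordlessByIndex (x ∷ ys)
    from (f , h) zero    zero    a = ⊥-elim (irrefl G a)
    from (f , h) zero    (suc j) a = inj₁ (cong suc (f j a))
    from (f , h) (suc i) zero    a = inj₂ (cong suc (f i (Graph.sym G a)))
    from (f , h) (suc i) (suc j) a = Sum.map (cong suc) (cong suc) (h i j a)

  CycleChordlessByIndex-∷ : ∀ x ys →
    CycleChordlessByIndex (x ∷ ys) ⇔
    (AdjacentOnlyAt x ys (λ k → k ≡ 0 ⊎ suc k ≡ length ys) × ChordlessByIndex ys)
  CycleChordlessByIndex-∷ x ys = mk⇔ to from
    where
    onlyEnds : ∀ {k} → CycConsec G (suc (length ys)) 0 (suc k) → k ≡ 0 ⊎ suc k ≡ length ys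
    onlyEnds (inj₁ e)                     = inj₁ (suc-injective e)
    onlyEnds (inj₂ (inj₂ (inj₁ (_ , e)))) = inj₂ (suc-injective e)
    onlyEnds⁻ : ∀ {k} → k ≡ 0 ⊎ suc k ≡ length ys → CycConsec G (suc (length ys)) 0 (suc k)
    onlyEnds⁻ (inj₁ e) = inj₁ (cong suc e)
    onlyEnds⁻ (inj₂ e) = inj₂ (inj₂ (inj₁ (refl , cong suc e)))
    inner : ∀ {i j} → CycConsec G (suc (length ys)) (suc i) (suc j) → j ≡ suc i ⊎ i ≡ suc j
    inner (inj₁ e)        = inj₁ (suc-injective e)
    inner (inj₂ (inj₁ e)) = inj₂ (suc-injective e)
    inner (inj₂ (inj₂ (inj₁ (() , _))))
    inner (inj₂ (inj₂ (inj₂ (() , _))))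
    to : CycleChordlessByIndex (x ∷ ys) →
         AdjacentOnlyAt x ys (λ k → k ≡ 0 ⊎ suc k ≡ length ys) × ChordlessByIndex ys
    to h = (λ j a → onlyEnds (h zero (suc j) a)) , (λ i j a → inner (h (suc i) (suc j) a))
    from : AdjacentOnlyAt x ys (λ k → k ≡ 0 ⊎ suc k ≡ length ys) × ChordlessByIndex ys →
           CycleChordlessByIndex (x ∷ ys)
    from (f , h) zero    zero    a = ⊥-elim (irrefl G a)
    from (f , h) zero    (suc j) a = onlyEnds⁻ (f j a)
    from (f , h) (suc i) zero    a = CycConsec-sym (onlyEnds⁻ (f i (Graph.sym G a)))
    from (f , h) (suc i) (suc j) a = Sum.map (cong suc) (inj₁ ∘ cong suc) (h i j a)

  adjacentOnlyAtHead : ∀ x ys → AdjacentOnlyAt x ys (_≡ 0) ⇔ NonAdjacent x (drop 1 ys)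
  adjacentOnlyAtHead x ys = mk⇔ (to ys) (from ys)
    where
    to : ∀ ys → AdjacentOnlyAt x ys (_≡ 0) → NonAdjacent x (drop 1 ys)
    to []       h = []
    to (y ∷ ys) h = All.tabulate λ u∈ a →
      1+n≢0 (h (suc (index u∈)) (subst (Adj G x) (lookup-index u∈) a))
    from : ∀ ys → NonAdjacent x (drop 1 ys) → AdjacentOnlyAt x ys (_≡ 0)
    from (y ∷ ys) f zero    a = refl
    from (y ∷ ys) f (suc j) a = ⊥-elim (All.lookup f (∈-lookup j) a)

  adjacentOnlyAtLast : ∀ x us z →
    AdjacentOnlyAt x (us ∷ʳ z) (λ k → suc k ≡ length (us ∷ʳ z)) ⇔ NonAdjacent x us
  adjacentOnlyAtLast x us z = mk⇔ (to us) (from us)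
    where
    to : ∀ us → AdjacentOnlyAt x (us ∷ʳ z) (λ k → suc k ≡ length (us ∷ʳ z)) → NonAdjacent x us
    to []       h = []
    to (u ∷ us) h =
      (λ a → 0≢1+n (trans (suc-injective (h zero a)) (length-∷ʳ us z))) ∷
      to us (λ j a → suc-injective (h (suc j) a))
    from : ∀ us → NonAdjacent x us →
           AdjacentOnlyAt x (us ∷ʳ z) (λ k → suc k ≡ length (us ∷ʳ z))
    from []       f        zero    a = refl
    from (u ∷ us) (¬a ∷ f) zero    a = ⊥-elim (¬a a)
    from (u ∷ us) (_ ∷ f)  (suc j) a = cong suc (from us f j a)

  adjacentOnlyAtEnds : ∀ x ws z →
    AdjacentOnlyAt x (ws ∷ʳ z) (λ k → k ≡ 0 ⊎ suc k ≡ length (ws ∷ʳ z)) ⇔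
    NonAdjacent x (drop 1 ws)
  adjacentOnlyAtEnds x []       z = mk⇔ (λ _ → []) (λ { _ zero _ → inj₁ refl })
  adjacentOnlyAtEnds x (w ∷ us) z = mk⇔ to from
    where
    notHead : ∀ {k} → suc k ≡ 0 ⊎ suc (suc k) ≡ length (w ∷ us ∷ʳ z) →
              suc k ≡ length (us ∷ʳ z)
    notHead (inj₂ e) = suc-injective e
    to : AdjacentOnlyAt x (w ∷ us ∷ʳ z) (λ k → k ≡ 0 ⊎ suc k ≡ length (w ∷ us ∷ʳ z)) →
         NonAdjacent x us
    to h = Equivalence.to (adjacentOnlyAtLast x us z) (λ j a → notHead (h (suc j) a))
    from : NonAdjacent x us →
           AdjacentOnlyAt x (w ∷ us ∷ʳ z) (λ k → k ≡ 0 ⊎ suc k ≡ length (w ∷ us ∷ʳ z))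
    from f zero    a = inj₁ refl
    from f (suc j) a = inj₂ (cong suc (Equivalence.from (adjacentOnlyAtLast x us z) f j a))

  ChordlessByIndex⇔Chordless : ∀ xs → ChordlessByIndex xs ⇔ Chordless xs
  ChordlessByIndex⇔Chordless xs = mk⇔ (to xs) (from xs)
    where
    to : ∀ xs → ChordlessByIndex xs → Chordless xs
    to []       h = tt
    to (x ∷ ys) h with Equivalence.to (ChordlessByIndex-∷ x ys) h
    ... | f , h′ = Equivalence.to (adjacentOnlyAtHead x ys) f , to ys h′
    from : ∀ xs → Chordless xs → ChordlessByIndex xs
    from []       _       ()
    from (x ∷ ys) (f , c) = Equivalence.from (ChordlessByIndex-∷ x ys)
      (Equivalence.from (adjacentOnlyAtHead x ys) f , from ys c)

  CycleChordlessByIndex⇔Chordless : ∀ x ws z →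
    CycleChordlessByIndex (x ∷ ws ∷ʳ z) ⇔ (Chordless (x ∷ ws) × Chordless (ws ∷ʳ z))
  CycleChordlessByIndex⇔Chordless x ws z = mk⇔ to from
    where
    to : CycleChordlessByIndex (x ∷ ws ∷ʳ z) → Chordless (x ∷ ws) × Chordless (ws ∷ʳ z)
    to h with Equivalence.to (CycleChordlessByIndex-∷ x (ws ∷ʳ z)) h
    ... | f , h′ with Equivalence.to (ChordlessByIndex⇔Chordless (ws ∷ʳ z)) h′
    ... | c = (Equivalence.to (adjacentOnlyAtEnds x ws z) f , proj₁ (Chordless-++⁻ ws c)) , c
    from : Chordless (x ∷ ws) × Chordless (ws ∷ʳ z) → CycleChordlessByIndex (x ∷ ws ∷ʳ z)
    from ((f , _) , c) = Equivalence.from (CycleChordlessByIndex-∷ x (ws ∷ʳ z))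
      (Equivalence.from (adjacentOnlyAtEnds x ws z) f ,
       Equivalence.from (ChordlessByIndex⇔Chordless (ws ∷ʳ z)) c)

  chordless-cycleOf⁺ : ∀ s q₁ t z q₂ →
    Chordless (pathOf s q₁ t) → Chordless (pathOf s (z ∷ q₂) t) → NoEdges q₁ (z ∷ q₂) →
    CycleChordlessByIndex (cycleOf s q₁ t (z ∷ q₂))
  chordless-cycleOf⁺ s q₁ t z q₂ c₁ c₂ q₁#q₂ =
    subst CycleChordlessByIndex (sym (cycleOf-∷ʳ s q₁ t z q₂))
      (Equivalence.from (CycleChordlessByIndex⇔Chordless s (q₁ ++ t ∷ R) z) (fromS , toZ))
    where
    R : List V
    R = reverse q₂
    c₂ʳ : Chordless (pathOf t (R ∷ʳ z) s)
    c₂ʳ = subst Chordless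
            (trans (pathOf-reverse s (z ∷ q₂) t) (cong (λ r → pathOf t r s) (ʳ++-defn q₂)))
            (Chordless-reverse c₂)
    cTRz : Chordless (t ∷ R ∷ʳ z)
    cTRz = proj₁ (Chordless-++⁻ (t ∷ R ∷ʳ z) c₂ʳ)
    R∷ʳz⊆ : ∀ {u} → u ∈ R ∷ʳ z → u ∈ z ∷ q₂
    R∷ʳz⊆ u∈ with ∈-∷ʳ⁻ R u∈
    ... | here refl = here refl
    ... | there u∈R = there (reverse⁻ (setoid V) u∈R)
    sq₁#R : NoEdges (s ∷ q₁) R
    sq₁#R (here refl) u∈ = All.lookup (proj₁ c₂) (∈-++⁺ˡ (reverse⁻ (setoid V) {xs = q₂} u∈))
    sq₁#R (there x∈)  u∈ = q₁#q₂ x∈ (there (reverse⁻ (setoid V) u∈))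
    fromS : Chordless (s ∷ q₁ ++ t ∷ R)
    fromS = Chordless-join (s ∷ q₁) c₁ (proj₁ (Chordless-++⁻ (t ∷ R) cTRz)) sq₁#R
    toZ : Chordless ((q₁ ++ t ∷ R) ∷ʳ z)
    toZ = subst Chordless (sym (++-assoc q₁ (t ∷ R) [ z ]))
            (Chordless-join q₁ (proj₂ c₁) cTRz (λ x∈ u∈ → q₁#q₂ x∈ (R∷ʳz⊆ u∈)))

  chordless-cycleOf⁻ : ∀ s x q₁ t z q₂ →
    CycleChordlessByIndex (cycleOf s (x ∷ q₁) t (z ∷ q₂)) → Chordless (pathOf s (z ∷ q₂) t)
  chordless-cycleOf⁻ s x q₁ t z q₂ h =
    s#q₂t , subst Chordless (pathOf-reverse′ z q₂ t) (Chordless-reverse cTRz)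
    where
    R : List V
    R = reverse q₂
    parts : (NonAdjacent s (q₁ ++ t ∷ R) × Chordless (x ∷ q₁ ++ t ∷ R)) ×
            Chordless ((x ∷ q₁ ++ t ∷ R) ∷ʳ z)
    parts = Equivalence.to (CycleChordlessByIndex⇔Chordless s (x ∷ q₁ ++ t ∷ R) z)
              (subst CycleChordlessByIndex (cycleOf-∷ʳ s (x ∷ q₁) t z q₂) h)
    s#tR : NonAdjacent s (t ∷ R)
    s#tR = All.++⁻ʳ q₁ (proj₁ (proj₁ parts))
    s#q₂t : NonAdjacent s (q₂ ∷ʳ t)
    s#q₂t = All.tabulate λ u∈ → All.lookup s#tR (q₂∷ʳt⊆ u∈)
      where
      q₂∷ʳt⊆ : ∀ {u} → u ∈ q₂ ∷ʳ t → u ∈ t ∷ R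
      q₂∷ʳt⊆ u∈ with ∈-∷ʳ⁻ q₂ u∈
      ... | here refl = here refl
      ... | there u∈q₂ = there (reverse⁺ (setoid V) u∈q₂)
    cTRz : Chordless (t ∷ R ∷ʳ z)
    cTRz = proj₂ (Chordless-++⁻ (x ∷ q₁)
             (subst Chordless (++-assoc (x ∷ q₁) (t ∷ R) [ z ]) (proj₂ parts)))

  IsInducedCycle-cycleOf⁺ : ∀ s q₁ t z q₂ →
    IsInducedPath G (pathOf s q₁ t) → IsInducedPath G (pathOf s (z ∷ q₂) t) →
    Disjoint q₁ (z ∷ q₂) → NoEdges q₁ (z ∷ q₂) → IsInducedCycle G (cycleOf s q₁ t (z ∷ q₂))
  IsInducedCycle-cycleOf⁺ s q₁ t z q₂ (p₁ , i₁) (p₂ , i₂) q₁#q₂ noEdges =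
    IsCycle-cycleOf⁺ s q₁ t (z ∷ q₂) p₁ p₂ q₁#q₂
      (3≤∣path∣+∣path∣ q₁ (z ∷ q₂) (∈-++⁺ʳ q₁ (here refl))) ,
    chordless-cycleOf⁺ s q₁ t z q₂ (chordless i₁) (chordless i₂) noEdges
    where
    chordless : ∀ {xs} → ChordlessByIndex xs → Chordless xs
    chordless {xs} = Equivalence.to (ChordlessByIndex⇔Chordless xs)

  IsInducedCycle-cycleOf⁻ : ∀ s x q₁ t z q₂ →
    IsInducedCycle G (cycleOf s (x ∷ q₁) t (z ∷ q₂)) → IsInducedPath G (pathOf s (z ∷ q₂) t)
  IsInducedCycle-cycleOf⁻ s x q₁ t z q₂ (c , i) =
    proj₂ (IsCycle-cycleOf⁻ s (x ∷ q₁) t (z ∷ q₂) c) ,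
    Equivalence.from (ChordlessByIndex⇔Chordless (pathOf s (z ∷ q₂) t))
      (chordless-cycleOf⁻ s x q₁ t z q₂ i)

  IsCycle-cycleOf-[]⇒Adj : ∀ s q₁ t → IsCycle G (cycleOf s q₁ t []) → Adj G s t
  IsCycle-cycleOf-[]⇒Adj s q₁ t c with IsCycle-cycleOf⁻ s q₁ t [] c
  ... | _ , (_ , s~t ∷ [-]) = s~t

  -- Chords and jumps

  chordCycles : ∀ {s t v w} A B C D →
    IsPath G (pathOf s (A ++ v ∷ B) t) → IsPath G (pathOf s (C ++ w ∷ D) t) →
    Disjoint (pathOf s (A ++ v ∷ B) t) (C ++ w ∷ D) → Adj G v w →
    IsCycle G (cycleOf s (A ∷ʳ v) w C) × IsCycle G (cycleOf v B t (w ∷ D))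
  chordCycles {s} {t} {v} {w} A B C D p q d v~w =
    IsCycle-cycleOf⁺ s (A ∷ʳ v) w C sAvw sCw Av#C
      (3≤∣path∣+∣path∣ (A ∷ʳ v) C (∈-++⁺ˡ (∈-++⁺ʳ A (here refl)))) ,
    IsCycle-cycleOf⁺ v B t (w ∷ D) vBt vwDt B#wD
      (3≤∣path∣+∣path∣ B (w ∷ D) (∈-++⁺ʳ B (here refl)))
    where
    d′ : Disjoint ((s ∷ A) ++ pathOf v B t) (C ++ w ∷ D)
    d′ = subst (λ xs → Disjoint xs (C ++ w ∷ D)) (pathOf-++ s A v B t) d
    sAv : IsPath G (pathOf s A v)
    sAv = proj₁ (IsPath-pathOf-split A B p)
    vBt : IsPath G (pathOf v B t)
    vBt = proj₂ (IsPath-pathOf-split A B p)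
    sCw : IsPath G (pathOf s C w)
    sCw = proj₁ (IsPath-pathOf-split C D q)
    wDt : IsPath G (pathOf w D t)
    wDt = proj₂ (IsPath-pathOf-split C D q)
    sAvw : IsPath G (pathOf s (A ∷ʳ v) w)
    sAvw = IsPath-pathOf-join A [] sAv (edge-isPath v~w) λ where
      (u∈ , here refl)         → proj₂ (proj₂ (Unique-++⁻ (s ∷ A) (proj₁ sAv))) (u∈ , here refl)
      (u∈ , there (here refl)) → d′ (∈-++⁺ˡ u∈ , ∈-++⁺ʳ C (here refl))
    vwDt : IsPath G (pathOf v (w ∷ D) t)
    vwDt = IsPath-pathOf-join [] D (edge-isPath v~w) wDt v#wDt
      where
      v#wDt : Disjoint [ v ] (pathOf w D t)
      v#wDt (here refl , u∈) with ∈-∷ʳ⁻ (w ∷ D) u∈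
      ... | here refl  = Unique[x∷xs]⇒x∉xs (proj₁ vBt) (∈-++⁺ʳ B (here refl))
      ... | there v∈wD = d′ (∈-++⁺ʳ (s ∷ A) (here refl) , ∈-++⁺ʳ C v∈wD)
    Av#C : Disjoint (A ∷ʳ v) C
    Av#C (u∈ , u∈C) with ∈-∷ʳ⁻ A u∈
    ... | here refl = d′ (∈-++⁺ʳ (s ∷ A) (here refl) , ∈-++⁺ˡ u∈C)
    ... | there u∈A = d′ (∈-++⁺ˡ (there u∈A) , ∈-++⁺ˡ u∈C)
    B#wD : Disjoint B (w ∷ D)
    B#wD (u∈B , u∈wD) = d′ (∈-++⁺ʳ (s ∷ A) (there (∈-++⁺ˡ u∈B)) , ∈-++⁺ʳ C u∈wD)

  chord⇒longCycleOf : ∀ ℓ s q₁ t q₂ p {v w} →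
    (∀ cs → IsCycle G cs → 2 * ℓ + 1 ≤ length cs) →
    IsCycle G (cycleOf s q₁ t q₂) → length (cycleOf s q₁ t q₂) ≤ 2 * ℓ + 2 → 2 ≤ ∣path∣ q₂ →
    IsPath G (pathOf s p t) → Disjoint (pathOf s q₁ t) p → v ∈ q₁ → w ∈ p → Adj G v w →
    2 * ℓ + 2 ≤ length (cycleOf s p t q₂)
  chord⇒longCycleOf ℓ s q₁ t q₂ p {v} {w} girth C C-short q₂≥2 P Q₁#P v∈ w∈ v~w
    with ∈-∃++ v∈ | ∈-∃++ w∈
  ... | A , B , refl | C′ , D , refl = subst (2 * ℓ + 2 ≤_) (sym ∣H∣)
        (chordArith (2 * ℓ) (∣path∣ A) (∣path∣ B) (∣path∣ C′) (∣path∣ D) (∣path∣ q₂)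
          ∣cycle₁∣ ∣cycle₂∣ ∣C∣ q₂≥2)
    where
    cycles : IsCycle G (cycleOf s (A ∷ʳ v) w C′) × IsCycle G (cycleOf v B t (w ∷ D))
    cycles = chordCycles A B C′ D (proj₁ (IsCycle-cycleOf⁻ s _ t q₂ C)) P Q₁#P v~w
    ∣cycle₁∣ : 2 * ℓ + 1 ≤ ∣path∣ A + 1 + ∣path∣ C′
    ∣cycle₁∣ = subst (2 * ℓ + 1 ≤_)
      (trans (length-cycleOf s (A ∷ʳ v) w C′) (cong (_+ ∣path∣ C′) (∣path∣-split A v [])))
      (girth _ (proj₁ cycles))
    ∣cycle₂∣ : 2 * ℓ + 1 ≤ ∣path∣ B + suc (∣path∣ D)
    ∣cycle₂∣ = subst (2 * ℓ + 1 ≤_) (length-cycleOf v B t (w ∷ D)) (girth _ (proj₂ cycles))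
    ∣C∣ : ∣path∣ A + ∣path∣ B + ∣path∣ q₂ ≤ 2 * ℓ + 2
    ∣C∣ = subst (_≤ 2 * ℓ + 2)
      (trans (length-cycleOf s (A ++ v ∷ B) t q₂) (cong (_+ ∣path∣ q₂) (∣path∣-split A v B)))
      C-short
    ∣H∣ : length (cycleOf s (C′ ++ w ∷ D) t q₂) ≡ ∣path∣ C′ + ∣path∣ D + ∣path∣ q₂
    ∣H∣ = trans (length-cycleOf s (C′ ++ w ∷ D) t q₂)
                (cong (_+ ∣path∣ q₂) (∣path∣-split C′ w D))

  localJump⇒inducedCycleOf : ∀ s x q₁ t z q₂ p →
    IsInducedCycle G (cycleOf s (x ∷ q₁) t (z ∷ q₂)) → IsJump G s t (x ∷ q₁) (z ∷ q₂) p →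
    NoEdges (z ∷ q₂) p → IsInducedCycle G (cycleOf s p t (z ∷ q₂))
  localJump⇒inducedCycleOf s x q₁ t z q₂ p C (P , P*∉C) Q₂*#P* =
    IsInducedCycle-cycleOf⁺ s p t z q₂ P (IsInducedCycle-cycleOf⁻ s x q₁ t z q₂ C)
      (λ (u∈p , u∈q₂) → P*∉C u∈p (∈q₂⇒∈cycleOf {q₁ = x ∷ q₁} u∈q₂))
      (λ u∈p u∈q₂ a → Q₂*#P* u∈q₂ u∈p (Graph.sym G a))

  OddLen-cycleOf⇒sameParity : ∀ s q₁ t q₂ p →
    OddLen G (cycleOf s q₁ t q₂) → OddLen G (cycleOf s q₁ t p) → ∣path∣ p % 2 ≡ ∣path∣ q₂ % 2
  OddLen-cycleOf⇒sameParity s q₁ t q₂ p C-odd P∪Q₁-odd =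
    oddSums⇒sameParity (∣path∣ q₁) (∣path∣ p) (∣path∣ q₂)
    (subst (λ m → m % 2 ≡ 1) (length-cycleOf s q₁ t p) P∪Q₁-odd)
    (subst (λ m → m % 2 ≡ 1) (length-cycleOf s q₁ t q₂) C-odd)

  localJump-sameParity : ∀ ℓ → 2 ≤ ℓ → (∀ cs → IsCycle G cs → 2 * ℓ + 1 ≤ length cs) →
    NoOddHoleOfLengthAtLeast G (2 * ℓ + 3) → ∀ s q₁ t q₂ p →
    IsOddHole G (cycleOf s q₁ t q₂) → ¬ Adj G s t → IsJump G s t q₁ q₂ p →
    IsLocalJumpAcross₁ G s t q₁ q₂ p → ∣path∣ p % 2 ≡ ∣path∣ q₂ % 2
  localJump-sameParity ℓ _ _ _ s q₁ t [] p (((C , _) , _) , _) ¬s~t _ _ =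
    ⊥-elim (¬s~t (IsCycle-cycleOf-[]⇒Adj s q₁ t C))
  localJump-sameParity ℓ _ _ _ s [] t (_ ∷ _) p _ _ _ ((_ , _ , () , _) , _)
  localJump-sameParity ℓ ℓ≥2 girth noLongOddHole s (x ∷ q₁) t (z ∷ q₂) p C-hole@((C , _) , _) _ P
    ((v , w , v∈ , w∈ , v~w) , Q₂*#P*) with sameParity⊎oddSum (∣path∣ p) (∣path∣ (z ∷ q₂))
  ... | inj₁ sameParity = sameParity
  ... | inj₂ H-odd      =
    ⊥-elim (noLongOddHole H ((H-induced , ≤-trans 4≤2ℓ+3 H-long) , H-odd′) H-long)
    where
    H : List V
    H = cycleOf s p t (z ∷ q₂)
    H-induced : IsInducedCycle G H
    H-induced = localJump⇒inducedCycleOf s x q₁ t z q₂ p C P Q₂*#P*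
    H-odd′ : OddLen G H
    H-odd′ = subst (λ m → m % 2 ≡ 1) (sym (length-cycleOf s p t (z ∷ q₂))) H-odd
    C-short : length (cycleOf s (x ∷ q₁) t (z ∷ q₂)) ≤ 2 * ℓ + 2
    C-short = ≤-pred (subst (length (cycleOf s (x ∷ q₁) t (z ∷ q₂)) <_) (+-suc (2 * ℓ) 2)
      (≰⇒> (noLongOddHole _ C-hole)))
    Q₁#P* : Disjoint (pathOf s (x ∷ q₁) t) p
    Q₁#P* (u∈ , u∈p) = proj₂ P u∈p (∈pathOf⇒∈cycleOf {q₁ = x ∷ q₁} {q₂ = z ∷ q₂} u∈)
    H-long : 2 * ℓ + 3 ≤ length H
    H-long = odd-above-even ℓ (length H)
      (chord⇒longCycleOf ℓ s (x ∷ q₁) t (z ∷ q₂) p girth (proj₁ C) C-short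
        (s≤s (m≤n+m 1 (length q₂))) (proj₁ (proj₁ P)) Q₁#P* v∈ w∈ v~w)
      H-odd′
    4≤2ℓ+3 : 4 ≤ 2 * ℓ + 3
    4≤2ℓ+3 = +-monoˡ-≤ 3 (≤-trans (s≤s z≤n) (≤-trans ℓ≥2 (m≤m+n ℓ (ℓ + 0))))

lemma4p1 : {n : ℕ} (G : Graph n) (ℓ : ℕ) → 2 ≤ ℓ →
    HasGirth G (2 * ℓ + 1) →
    NoOddHoleOfLengthAtLeast G (2 * ℓ + 3) →
    (s t : Fin n) (q₁ q₂ : List (Fin n)) →
    IsOddHole G (cycleOf s q₁ t q₂) →
    ¬ Adj G s t →
    (p : List (Fin n)) →
    IsJump G s t q₁ q₂ p →
    IsLocalJumpAcross₁ G s t q₁ q₂ p ⊎ IsShortJumpAcross₁ G s t q₁ q₂ p →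
    ∣path∣ p % 2 ≡ ∣path∣ q₂ % 2
lemma4p1 G ℓ ℓ≥2 (_ , girth) noLongOddHole s t q₁ q₂ C ¬s~t p P (inj₁ local) =
  localJump-sameParity G ℓ ℓ≥2 girth noLongOddHole s q₁ t q₂ p C ¬s~t P local
lemma4p1 G ℓ _ _ _ s t q₁ q₂ C _ p _ (inj₂ (_ , _ , P∪Q₁)) =
  OddLen-cycleOf⇒sameParity G s q₁ t q₂ p (proj₂ C) (proj₂ P∪Q₁)
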